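{- Let $L$ be an LLA, let $a,b$ be finite tuples from $L$, and let $C$ be a sub-LLA of $L$. Then: (1) if $a$ is Malcev over $\langle Cb\rangle$ and $b$ is Malcev over $C$, then the concatenation $ab$ is Malcev over $C$; (2) if $b$ is Malcev over $C$ and $ab$ is Malcev over $C$, then $a$ is Malcev over $\langle Cb\rangle$; (3) if $a$ is Malcev over $\langle Cb\rangle$ and $ab$ is Malcev over $C$, then $b$ is Malcev over $C$.
   Context: Fix a field $\mathbb{F}$ and $c\ge 1$. An LLA (Lazard Lie algebra) is a Lie algebra $L$ over $\mathbb{F}$ together with subalgebras $L=P_1(L)\supseteq P_2(L)\supseteq\dots\supseteq P_{c+1}(L)=0$ with $[P_i(L),P_j(L)]\subseteq P_{i+j}(L)$ for all $i,j$ (where $P_k(L)=0$ for $k>c$); sub-LLAs carry the induced series $P_i\cap$. $\langle X\rangle$ denotes the sub-LLA generated by $X$. A tuple $a=(a_1,\dots,a_n)$ is Malcev over a sub-LLA $C$ if $a$ is linearly independent over $C$ and for all $i=1,\dots,c$, $\operatorname{span}_{\mathbb{F}}(C\cup P_i(\langle Ca\rangle))=\operatorname{span}_{\mathbb{F}}(C\cup P_i(a))$, where $P_i(a)$ is the subtuple of $a$ consisting of entries lying in $P_i(L)$. -}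

module Defs where

open import Level using (Level; _⊔_) renaming (suc to lsuc)
open import Data.Nat using (ℕ; zero; suc; _+_; _≤_; _<_)
open import Data.Fin using (Fin; zero; suc)
open import Data.Product using (Σ; _×_; _,_)
open import Data.Sum using (_⊎_)
open import Relation.Nullary using (¬_)
open import Relation.Unary using (Pred)
open import Algebra.Bundles using (CommutativeRing)
open import Algebra.Module.Bundles using (LeftModule)

record Field (f ℓ : Level) : Set (lsuc (f ⊔ ℓ)) where
  field
    commutativeRing : CommutativeRing f ℓ
  open CommutativeRing commutativeRing public
  field
    0≉1 : ¬ (0# ≈ 1#)
    inverse : ∀ x → ¬ (x ≈ 0#) → Σ Carrier λ y → x * y ≈ 1#

record LieAlgebra {f ℓf : Level} (F : Field f ℓf) (m ℓm : Level)
       : Set (f ⊔ ℓf ⊔ lsuc (m ⊔ ℓm)) where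
  open Field F
  field
    leftModule : LeftModule ring m ℓm
  open LeftModule leftModule public
  field
    [_,_] : Carrierᴹ → Carrierᴹ → Carrierᴹ
    [,]-cong : ∀ {x x′ y y′} → x ≈ᴹ x′ → y ≈ᴹ y′ → [ x , y ] ≈ᴹ [ x′ , y′ ]
    [,]-+ˡ : ∀ x y z → [ x +ᴹ y , z ] ≈ᴹ [ x , z ] +ᴹ [ y , z ]
    [,]-+ʳ : ∀ x y z → [ x , y +ᴹ z ] ≈ᴹ [ x , y ] +ᴹ [ x , z ]
    [,]-*ˡ : ∀ (r : Carrier) x y → [ r *ₗ x , y ] ≈ᴹ r *ₗ [ x , y ]
    [,]-*ʳ : ∀ (r : Carrier) x y → [ x , r *ₗ y ] ≈ᴹ r *ₗ [ x , y ]
    alternating : ∀ x → [ x , x ] ≈ᴹ 0ᴹ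
    jacobi : ∀ x y z →
      ([ x , [ y , z ] ] +ᴹ [ y , [ z , x ] ]) +ᴹ [ z , [ x , y ] ] ≈ᴹ 0ᴹ

module _ {f ℓf m ℓm : Level} {F : Field f ℓf} (L : LieAlgebra F m ℓm) where
  open Field F using () renaming (Carrier to K; _≈_ to _≈K_; 0# to 0K)
  open LieAlgebra L

  _∪_ : ∀ {p q} → Pred Carrierᴹ p → Pred Carrierᴹ q → Pred Carrierᴹ (p ⊔ q)
  (A ∪ B) x = A x ⊎ B x

  _⊆_ : ∀ {p q} → Pred Carrierᴹ p → Pred Carrierᴹ q → Set (m ⊔ p ⊔ q)
  A ⊆ B = ∀ {x} → A x → B x

  _≐_ : ∀ {p q} → Pred Carrierᴹ p → Pred Carrierᴹ q → Set (m ⊔ p ⊔ q)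
  A ≐ B = (A ⊆ B) × (B ⊆ A)

  record IsSubalgebra {p} (S : Pred Carrierᴹ p) : Set (f ⊔ m ⊔ ℓm ⊔ p) where
    field
      resp : ∀ {x y} → x ≈ᴹ y → S x → S y
      zero∈ : S 0ᴹ
      +∈ : ∀ {x y} → S x → S y → S (x +ᴹ y)
      *∈ : ∀ (r : K) {x} → S x → S (r *ₗ x)
      [,]∈ : ∀ {x y} → S x → S y → S [ x , y ]

  Img : ∀ {n} → (Fin n → Carrierᴹ) → Pred Carrierᴹ ℓm
  Img {n} a x = Σ (Fin n) λ j → x ≈ᴹ a j

  data Span {p} (X : Pred Carrierᴹ p) : Pred Carrierᴹ (f ⊔ m ⊔ ℓm ⊔ p) where
    inj : ∀ {x} → X x → Span X x
    zero∈ : Span X 0ᴹ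
    +∈ : ∀ {x y} → Span X x → Span X y → Span X (x +ᴹ y)
    *∈ : ∀ (r : K) {x} → Span X x → Span X (r *ₗ x)
    resp : ∀ {x y} → x ≈ᴹ y → Span X x → Span X y

  data Gen {p} (X : Pred Carrierᴹ p) : Pred Carrierᴹ (f ⊔ m ⊔ ℓm ⊔ p) where
    inj : ∀ {x} → X x → Gen X x
    zero∈ : Gen X 0ᴹ
    +∈ : ∀ {x y} → Gen X x → Gen X y → Gen X (x +ᴹ y)
    *∈ : ∀ (r : K) {x} → Gen X x → Gen X (r *ₗ x)
    [,]∈ : ∀ {x y} → Gen X x → Gen X y → Gen X [ x , y ]
    resp : ∀ {x y} → x ≈ᴹ y → Gen X x → Gen X y

  lincomb : ∀ {n} → (Fin n → K) → (Fin n → Carrierᴹ) → Carrierᴹ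
  lincomb {zero} λs a = 0ᴹ
  lincomb {suc n} λs a = (λs zero *ₗ a zero) +ᴹ lincomb (λ j → λs (suc j)) (λ j → a (suc j))

  LinIndepOver : ∀ {p n} → Pred Carrierᴹ p → (Fin n → Carrierᴹ) → Set (f ⊔ ℓf ⊔ p)
  LinIndepOver {n = n} C a = ∀ (λs : Fin n → K) → C (lincomb λs a) → ∀ j → λs j ≈K 0K

-- Lazard Lie algebra of class (at most) c
record LLA {f ℓf : Level} (F : Field f ℓf) (c : ℕ) (m ℓm ℓp : Level)
       : Set (f ⊔ ℓf ⊔ lsuc (m ⊔ ℓm ⊔ ℓp)) where
  field
    lie : LieAlgebra F m ℓm
  open LieAlgebra lie public
  field
    P : ℕ → Pred Carrierᴹ ℓp
    P-sub : ∀ i → 1 ≤ i → IsSubalgebra lie (P i)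
    P-one : ∀ x → P 1 x
    P-dec : ∀ i → 1 ≤ i → ∀ {x} → P (suc i) x → P i x
    P-vanish : ∀ k → c < k → ∀ {x} → P k x → x ≈ᴹ 0ᴹ
    P-bracket : ∀ i j → 1 ≤ i → 1 ≤ j → ∀ {x y} → P i x → P j y → P (i + j) [ x , y ]

module _ {f ℓf : Level} {F : Field f ℓf} {c : ℕ} {m ℓm ℓp : Level}
         (L : LLA F c m ℓm ℓp) where
  open LLA L

  Pᵢ-of : ∀ {n} → ℕ → (Fin n → Carrierᴹ) → Pred Carrierᴹ (ℓm ⊔ ℓp)
  Pᵢ-of {n} i a x = Σ (Fin n) λ j → P i (a j) × (x ≈ᴹ a j)

  ⟨_∙_⟩ : ∀ {p n} → Pred Carrierᴹ p → (Fin n → Carrierᴹ) → Pred Carrierᴹ (f ⊔ m ⊔ ℓm ⊔ p)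
  ⟨ C ∙ a ⟩ = Gen lie (_∪_ lie C (Img lie a))

  Malcev : ∀ {p n} → Pred Carrierᴹ p → (Fin n → Carrierᴹ) → Set (f ⊔ ℓf ⊔ m ⊔ ℓm ⊔ ℓp ⊔ p)
  Malcev C a =
    LinIndepOver lie C a ×
    (∀ i → 1 ≤ i → i ≤ c →
      _≐_ lie (Span lie (_∪_ lie C (λ x → P i x × ⟨ C ∙ a ⟩ x)))
              (Span lie (_∪_ lie C (Pᵢ-of i a))))

-- Since ⟨⟨Cb⟩a⟩ = ⟨C ab⟩, all three parts compare the same pieces P_i ∩ ⟨C ab⟩.
-- Independence behaves like extending a basis: ab is independent over C iff b is
-- independent over C and a is independent over C + span b; and if b is Malcev over C,
-- the case i = 1 gives ⟨Cb⟩ = C + span b. For the spanning condition in part 1, write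
-- x ∈ P_i ∩ ⟨C ab⟩ as d + s with d ∈ ⟨Cb⟩ and s a combination of the P_i-entries of a;
-- then d ∈ P_i ∩ ⟨Cb⟩ as well. In part 3, write x ∈ P_i ∩ ⟨Cb⟩ as r + s with
-- r ∈ C + span P_i(b) and s ∈ span a; then s ∈ ⟨Cb⟩, so s = 0 by independence of a.

module Submission where

open import Defs hiding (_∪_; _⊆_)
open import Level using (Level; _⊔_)
open import Data.Nat using (ℕ; _≤_; zero; suc; _+_)
open import Data.Nat.Properties using (≤-refl)
open import Data.Fin using (Fin; zero; suc; _↑ˡ_; _↑ʳ_; splitAt)
open import Data.Fin.Properties using (splitAt⁻¹-↑ˡ; splitAt⁻¹-↑ʳ)
open import Data.Product using (Σ; ∃₂; _×_; _,_; proj₁)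
open import Data.Sum using (_⊎_; inj₁; inj₂; [_,_]′; map₂)
open import Data.Vec.Functional using (_++_)
open import Data.Vec.Functional.Properties using (lookup-++ˡ; lookup-++ʳ)
open import Function using (_∘_)
open import Relation.Binary.PropositionalEquality using (_≡_; refl; sym; subst)
open import Relation.Unary using (Pred; _∪_; _∩_; _⊆_)
open import Algebra.Bundles using (CommutativeMonoid)
import Algebra.Properties.CommutativeSemigroup as CommutativeSemigroupProperties
import Algebra.Properties.Group as GroupProperties
import Algebra.Module.Properties.LeftModule as LeftModuleProperties
import Relation.Binary.Reasoning.Setoid as SetoidReasoning

module _ {n k : ℕ} where

  ↑-elim : ∀ {q} {Q : Fin (n + k) → Set q} →
           (∀ i → Q (i ↑ˡ k)) → (∀ j → Q (n ↑ʳ j)) → ∀ i → Q i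
  ↑-elim {Q = Q} left right i with splitAt n i in eq
  ... | inj₁ j = subst Q (splitAt⁻¹-↑ˡ eq) (left j)
  ... | inj₂ j = subst Q (splitAt⁻¹-↑ʳ eq) (right j)

  module _ {a q} {A : Set a} (R : A → Set q) (u : Fin n → A) (v : Fin k → A) where

    ∃-++⁻ : Σ (Fin (n + k)) (R ∘ (u ++ v)) → Σ (Fin n) (R ∘ u) ⊎ Σ (Fin k) (R ∘ v)
    ∃-++⁻ (i , r) =
      ↑-elim {Q = λ i → R ((u ++ v) i) → Σ (Fin n) (R ∘ u) ⊎ Σ (Fin k) (R ∘ v)}
        (λ j r → inj₁ (j , subst R (lookup-++ˡ u v j) r))
        (λ j r → inj₂ (j , subst R (lookup-++ʳ u v j) r))
        i r

    ∃-++⁺ˡ : Σ (Fin n) (R ∘ u) → Σ (Fin (n + k)) (R ∘ (u ++ v))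
    ∃-++⁺ˡ (j , r) = j ↑ˡ k , subst R (sym (lookup-++ˡ u v j)) r

    ∃-++⁺ʳ : Σ (Fin k) (R ∘ v) → Σ (Fin (n + k)) (R ∘ (u ++ v))
    ∃-++⁺ʳ (j , r) = n ↑ʳ j , subst R (sym (lookup-++ʳ u v j)) r

lookup-++-suc : ∀ {a} {A : Set a} {n k} (u : Fin (suc n) → A) (v : Fin k → A) j →
                (u ++ v) (suc j) ≡ ((u ∘ suc) ++ v) j
lookup-++-suc {n = n} u v j with splitAt n j
... | inj₁ _ = refl
... | inj₂ _ = refl

module LinearAlgebra {f ℓf m ℓm : Level} {F : Field f ℓf} (𝔤 : LieAlgebra F m ℓm) where
  open Field F using (0#; 1#; -_; _*_; -‿inverseʳ)
    renaming (Carrier to K; _≈_ to _≈K_; _+_ to _+K_; refl to ≈K-refl; reflexive to ≈K-reflexive)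
  open LieAlgebra 𝔤
  open SetoidReasoning ≈ᴹ-setoid
  open CommutativeSemigroupProperties
    (CommutativeMonoid.commutativeSemigroup +ᴹ-commutativeMonoid) using (interchange)
  open GroupProperties +ᴹ-group using (//-rightDividesʳ)
  open LeftModuleProperties leftModule using (inverseʳ-uniqueᴹ)

  private
    variable
      ℓx ℓy ℓs ℓt : Level
      X : Pred Carrierᴹ ℓx
      Y : Pred Carrierᴹ ℓy
      S : Pred Carrierᴹ ℓs
      T : Pred Carrierᴹ ℓt
      n k : ℕ

  -1*ₗx≈-ᴹx : ∀ x → (- 1#) *ₗ x ≈ᴹ -ᴹ x
  -1*ₗx≈-ᴹx x = inverseʳ-uniqueᴹ x ((- 1#) *ₗ x) (begin
    x +ᴹ (- 1#) *ₗ x        ≈⟨ +ᴹ-congʳ (*ₗ-identityˡ x) ⟨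
    1# *ₗ x +ᴹ (- 1#) *ₗ x  ≈⟨ *ₗ-distribʳ x 1# (- 1#) ⟨
    (1# +K - 1#) *ₗ x       ≈⟨ *ₗ-congʳ (-‿inverseʳ 1#) ⟩
    0# *ₗ x                 ≈⟨ *ₗ-zeroˡ x ⟩
    0ᴹ                      ∎)

  record IsSubspace (S : Pred Carrierᴹ ℓs) : Set (f ⊔ m ⊔ ℓm ⊔ ℓs) where
    field
      ∈-resp : ∀ {x y} → x ≈ᴹ y → S x → S y
      0ᴹ∈    : S 0ᴹ
      +ᴹ-∈   : ∀ {x y} → S x → S y → S (x +ᴹ y)
      *ₗ-∈   : ∀ r {x} → S x → S (r *ₗ x)

    -ᴹ-∈ : ∀ {x} → S x → S (-ᴹ x)
    -ᴹ-∈ {x} x∈S = ∈-resp (-1*ₗx≈-ᴹx x) (*ₗ-∈ (- 1#) x∈S)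

    ∈-cancelʳ : ∀ {x u v} → x ≈ᴹ u +ᴹ v → S x → S v → S u
    ∈-cancelʳ {x} {u} {v} x≈u+v x∈S v∈S = ∈-resp (begin
      x +ᴹ -ᴹ v       ≈⟨ +ᴹ-congʳ x≈u+v ⟩
      u +ᴹ v +ᴹ -ᴹ v  ≈⟨ //-rightDividesʳ v u ⟩
      u               ∎) (+ᴹ-∈ x∈S (-ᴹ-∈ v∈S))

    ∈-cancelˡ : ∀ {x u v} → x ≈ᴹ u +ᴹ v → S x → S u → S v
    ∈-cancelˡ x≈u+v = ∈-cancelʳ (≈ᴹ-trans x≈u+v (+ᴹ-comm _ _))

    lincomb-∈ : ∀ {n} (λs : Fin n → K) {a : Fin n → Carrierᴹ} →
                (∀ j → S (a j)) → S (lincomb 𝔤 λs a)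
    lincomb-∈ {zero}  λs a∈S = 0ᴹ∈
    lincomb-∈ {suc n} λs a∈S =
      +ᴹ-∈ (*ₗ-∈ (λs zero) (a∈S zero)) (lincomb-∈ (λs ∘ suc) (a∈S ∘ suc))

  IsSubalgebra⇒IsSubspace : IsSubalgebra 𝔤 S → IsSubspace S
  IsSubalgebra⇒IsSubspace S-sub = record
    { ∈-resp = S.resp ; 0ᴹ∈ = S.zero∈ ; +ᴹ-∈ = S.+∈ ; *ₗ-∈ = S.*∈ }
    where module S = IsSubalgebra S-sub

  Span-isSubspace : IsSubspace (Span 𝔤 X)
  Span-isSubspace = record { ∈-resp = resp ; 0ᴹ∈ = zero∈ ; +ᴹ-∈ = +∈ ; *ₗ-∈ = *∈ }

  Gen-isSubalgebra : IsSubalgebra 𝔤 (Gen 𝔤 X)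
  Gen-isSubalgebra = record
    { resp = resp ; zero∈ = zero∈ ; +∈ = +∈ ; *∈ = *∈ ; [,]∈ = [,]∈ }

  Span-least : IsSubspace S → X ⊆ S → Span 𝔤 X ⊆ S
  Span-least {S = S} {X = X} S-sub X⊆S = go
    where
    open IsSubspace S-sub
    go : Span 𝔤 X ⊆ S
    go (inj x∈X)    = X⊆S x∈X
    go zero∈        = 0ᴹ∈
    go (+∈ x∈ y∈)   = +ᴹ-∈ (go x∈) (go y∈)
    go (*∈ r x∈)    = *ₗ-∈ r (go x∈)
    go (resp eq x∈) = ∈-resp eq (go x∈)

  Gen-least : IsSubalgebra 𝔤 S → X ⊆ S → Gen 𝔤 X ⊆ S
  Gen-least {S = S} {X = X} S-sub X⊆S = go
    where
    module S = IsSubalgebra S-sub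
    go : Gen 𝔤 X ⊆ S
    go (inj x∈X)    = X⊆S x∈X
    go zero∈        = S.zero∈
    go (+∈ x∈ y∈)   = S.+∈ (go x∈) (go y∈)
    go (*∈ r x∈)    = S.*∈ r (go x∈)
    go ([,]∈ x∈ y∈) = S.[,]∈ (go x∈) (go y∈)
    go (resp eq x∈) = S.resp eq (go x∈)

  Span-mono : X ⊆ Y → Span 𝔤 X ⊆ Span 𝔤 Y
  Span-mono X⊆Y = Span-least Span-isSubspace (inj ∘ X⊆Y)

  Gen-mono : X ⊆ Y → Gen 𝔤 X ⊆ Gen 𝔤 Y
  Gen-mono X⊆Y = Gen-least Gen-isSubalgebra (inj ∘ X⊆Y)

  Span⊆Gen : Span 𝔤 X ⊆ Gen 𝔤 X
  Span⊆Gen = Span-least (IsSubalgebra⇒IsSubspace Gen-isSubalgebra) inj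

  _⊕_ : Pred Carrierᴹ ℓs → Pred Carrierᴹ ℓt → Pred Carrierᴹ (m ⊔ ℓm ⊔ ℓs ⊔ ℓt)
  (S ⊕ T) x = ∃₂ λ u v → S u × T v × x ≈ᴹ u +ᴹ v

  ⊕-isSubspace : IsSubspace S → IsSubspace T → IsSubspace (S ⊕ T)
  ⊕-isSubspace S-sub T-sub = record
    { ∈-resp = λ { x≈y (u , v , u∈ , v∈ , x≈) →
                 u , v , u∈ , v∈ , ≈ᴹ-trans (≈ᴹ-sym x≈y) x≈ }
    ; 0ᴹ∈    = 0ᴹ , 0ᴹ , S.0ᴹ∈ , T.0ᴹ∈ , ≈ᴹ-sym (+ᴹ-identityˡ 0ᴹ)
    ; +ᴹ-∈   = λ { (u , v , u∈ , v∈ , x≈) (u′ , v′ , u′∈ , v′∈ , y≈) →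
                 u +ᴹ u′ , v +ᴹ v′ , S.+ᴹ-∈ u∈ u′∈ , T.+ᴹ-∈ v∈ v′∈ ,
                 ≈ᴹ-trans (+ᴹ-cong x≈ y≈) (interchange u v u′ v′) }
    ; *ₗ-∈   = λ { r (u , v , u∈ , v∈ , x≈) →
                 r *ₗ u , r *ₗ v , S.*ₗ-∈ r u∈ , T.*ₗ-∈ r v∈ ,
                 ≈ᴹ-trans (*ₗ-congˡ x≈) (*ₗ-distribˡ r u v) }
    }
    where
    module S = IsSubspace S-sub
    module T = IsSubspace T-sub

  Span-∪⊆⊕ : IsSubspace S → Span 𝔤 (S ∪ X) ⊆ S ⊕ Span 𝔤 X
  Span-∪⊆⊕ S-sub = Span-least (⊕-isSubspace S-sub Span-isSubspace)
    [ (λ u∈ → _ , 0ᴹ , u∈ , zero∈ , ≈ᴹ-sym (+ᴹ-identityʳ _))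
    , (λ v∈ → 0ᴹ , _ , IsSubspace.0ᴹ∈ S-sub , inj v∈ , ≈ᴹ-sym (+ᴹ-identityˡ _))
    ]′

  Img-++⁻ : (a : Fin n → Carrierᴹ) (b : Fin k → Carrierᴹ) →
            Img 𝔤 (a ++ b) ⊆ Img 𝔤 a ∪ Img 𝔤 b
  Img-++⁻ a b {x} = ∃-++⁻ (x ≈ᴹ_) a b

  Img-++⁺ˡ : (a : Fin n → Carrierᴹ) (b : Fin k → Carrierᴹ) → Img 𝔤 a ⊆ Img 𝔤 (a ++ b)
  Img-++⁺ˡ a b {x} = ∃-++⁺ˡ (x ≈ᴹ_) a b

  Img-++⁺ʳ : (a : Fin n → Carrierᴹ) (b : Fin k → Carrierᴹ) → Img 𝔤 b ⊆ Img 𝔤 (a ++ b)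
  Img-++⁺ʳ a b {x} = ∃-++⁺ʳ (x ≈ᴹ_) a b

  lincomb-congˡ : ∀ {λs μs : Fin n → K} a → (∀ j → λs j ≈K μs j) →
                  lincomb 𝔤 λs a ≈ᴹ lincomb 𝔤 μs a
  lincomb-congˡ {zero}  a λs≈μs = ≈ᴹ-refl
  lincomb-congˡ {suc n} a λs≈μs =
    +ᴹ-cong (*ₗ-congʳ (λs≈μs zero)) (lincomb-congˡ (a ∘ suc) (λs≈μs ∘ suc))

  lincomb-congʳ : ∀ (λs : Fin n → K) {a b} → (∀ j → a j ≈ᴹ b j) →
                  lincomb 𝔤 λs a ≈ᴹ lincomb 𝔤 λs b
  lincomb-congʳ {zero}  λs a≈b = ≈ᴹ-refl
  lincomb-congʳ {suc n} λs a≈b =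
    +ᴹ-cong (*ₗ-congˡ (a≈b zero)) (lincomb-congʳ (λs ∘ suc) (a≈b ∘ suc))

  lincomb-zero : ∀ {λs : Fin n → K} a → (∀ j → λs j ≈K 0#) → lincomb 𝔤 λs a ≈ᴹ 0ᴹ
  lincomb-zero {zero}  a λs≈0 = ≈ᴹ-refl
  lincomb-zero {suc n} a λs≈0 = begin
    _ ≈⟨ +ᴹ-cong (*ₗ-congʳ (λs≈0 zero)) (lincomb-zero (a ∘ suc) (λs≈0 ∘ suc)) ⟩
    0# *ₗ a zero +ᴹ 0ᴹ ≈⟨ +ᴹ-identityʳ _ ⟩
    0# *ₗ a zero       ≈⟨ *ₗ-zeroˡ (a zero) ⟩
    0ᴹ                 ∎

  lincomb-+ : ∀ (λs μs : Fin n → K) a →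
              lincomb 𝔤 (λ j → λs j +K μs j) a ≈ᴹ lincomb 𝔤 λs a +ᴹ lincomb 𝔤 μs a
  lincomb-+ {zero}  λs μs a = ≈ᴹ-sym (+ᴹ-identityˡ 0ᴹ)
  lincomb-+ {suc n} λs μs a = ≈ᴹ-trans
    (+ᴹ-cong (*ₗ-distribʳ (a zero) (λs zero) (μs zero))
             (lincomb-+ (λs ∘ suc) (μs ∘ suc) (a ∘ suc)))
    (interchange _ _ _ _)

  lincomb-* : ∀ r (λs : Fin n → K) a → lincomb 𝔤 (λ j → r * λs j) a ≈ᴹ r *ₗ lincomb 𝔤 λs a
  lincomb-* {zero}  r λs a = ≈ᴹ-sym (*ₗ-zeroʳ r)
  lincomb-* {suc n} r λs a = ≈ᴹ-trans
    (+ᴹ-cong (*ₗ-assoc r (λs zero) (a zero)) (lincomb-* r (λs ∘ suc) (a ∘ suc)))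
    (≈ᴹ-sym (*ₗ-distribˡ r _ _))

  unit : Fin n → Fin n → K
  unit zero    zero    = 1#
  unit zero    (suc _) = 0#
  unit (suc _) zero    = 0#
  unit (suc j) (suc i) = unit j i

  lincomb-unit : ∀ (j : Fin n) a → lincomb 𝔤 (unit j) a ≈ᴹ a j
  lincomb-unit zero a = begin
    _                      ≈⟨ +ᴹ-congˡ (lincomb-zero (a ∘ suc) (λ _ → ≈K-refl)) ⟩
    1# *ₗ a zero +ᴹ 0ᴹ     ≈⟨ +ᴹ-identityʳ _ ⟩
    1# *ₗ a zero           ≈⟨ *ₗ-identityˡ (a zero) ⟩
    a zero                 ∎
  lincomb-unit (suc j) a = begin
    _                                    ≈⟨ +ᴹ-congʳ (*ₗ-zeroˡ (a zero)) ⟩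
    0ᴹ +ᴹ lincomb 𝔤 (unit j) (a ∘ suc)   ≈⟨ +ᴹ-identityˡ _ ⟩
    lincomb 𝔤 (unit j) (a ∘ suc)         ≈⟨ lincomb-unit j (a ∘ suc) ⟩
    a (suc j)                            ∎

  Span-Img⇒lincomb : ∀ {a : Fin n → Carrierᴹ} {x} → Span 𝔤 (Img 𝔤 a) x →
                     Σ (Fin n → K) λ λs → x ≈ᴹ lincomb 𝔤 λs a
  Span-Img⇒lincomb {a = a} (inj (j , x≈aj)) =
    unit j , ≈ᴹ-trans x≈aj (≈ᴹ-sym (lincomb-unit j a))
  Span-Img⇒lincomb {a = a} zero∈ =
    (λ _ → 0#) , ≈ᴹ-sym (lincomb-zero a (λ _ → ≈K-refl))
  Span-Img⇒lincomb {a = a} (+∈ x∈ y∈) with Span-Img⇒lincomb x∈ | Span-Img⇒lincomb y∈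
  ... | λs , x≈ | μs , y≈ =
    (λ j → λs j +K μs j) , ≈ᴹ-trans (+ᴹ-cong x≈ y≈) (≈ᴹ-sym (lincomb-+ λs μs a))
  Span-Img⇒lincomb {a = a} (*∈ r x∈) with Span-Img⇒lincomb x∈
  ... | λs , x≈ = (λ j → r * λs j) , ≈ᴹ-trans (*ₗ-congˡ x≈) (≈ᴹ-sym (lincomb-* r λs a))
  Span-Img⇒lincomb (resp y≈x y∈) with Span-Img⇒lincomb y∈
  ... | λs , y≈ = λs , ≈ᴹ-trans (≈ᴹ-sym y≈x) y≈

  lincomb-++ : ∀ n {k} (λs : Fin (n + k) → K) a b →
               lincomb 𝔤 λs (a ++ b)
                 ≈ᴹ lincomb 𝔤 (λs ∘ (_↑ˡ k)) a +ᴹ lincomb 𝔤 (λs ∘ (n ↑ʳ_)) b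
  lincomb-++ zero        λs a b = ≈ᴹ-sym (+ᴹ-identityˡ _)
  lincomb-++ (suc n) {k} λs a b = begin
    λs zero *ₗ a zero +ᴹ lincomb 𝔤 (λs ∘ suc) ((a ++ b) ∘ suc)
      ≈⟨ +ᴹ-congˡ (lincomb-congʳ (λs ∘ suc) (≈ᴹ-reflexive ∘ lookup-++-suc a b)) ⟩
    λs zero *ₗ a zero +ᴹ lincomb 𝔤 (λs ∘ suc) ((a ∘ suc) ++ b)
      ≈⟨ +ᴹ-congˡ (lincomb-++ n (λs ∘ suc) (a ∘ suc) b) ⟩
    λs zero *ₗ a zero
      +ᴹ (lincomb 𝔤 (λs ∘ suc ∘ (_↑ˡ k)) (a ∘ suc) +ᴹ lincomb 𝔤 (λs ∘ suc ∘ (n ↑ʳ_)) b)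
      ≈⟨ +ᴹ-assoc _ _ _ ⟨
    lincomb 𝔤 (λs ∘ (_↑ˡ k)) a +ᴹ lincomb 𝔤 (λs ∘ (suc n ↑ʳ_)) b
      ∎

  lincomb-++-++ : ∀ (λs : Fin n → K) (μs : Fin k → K) a b →
                  lincomb 𝔤 (λs ++ μs) (a ++ b) ≈ᴹ lincomb 𝔤 λs a +ᴹ lincomb 𝔤 μs b
  lincomb-++-++ {n} λs μs a b = ≈ᴹ-trans (lincomb-++ n (λs ++ μs) a b) (+ᴹ-cong
    (lincomb-congˡ a (≈K-reflexive ∘ lookup-++ˡ λs μs))
    (lincomb-congˡ b (≈K-reflexive ∘ lookup-++ʳ λs μs)))

  LinIndepOver-anti : ∀ {a : Fin n → Carrierᴹ} →
                      X ⊆ Y → LinIndepOver 𝔤 Y a → LinIndepOver 𝔤 X a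
  LinIndepOver-anti X⊆Y Y-indep λs combination∈X = Y-indep λs (X⊆Y combination∈X)

  LinIndepOver⇒Span∩≈0 : ∀ {a : Fin n → Carrierᴹ} → IsSubspace S → LinIndepOver 𝔤 S a →
                         ∀ {x} → Span 𝔤 (Img 𝔤 a) x → S x → x ≈ᴹ 0ᴹ
  LinIndepOver⇒Span∩≈0 {a = a} S-sub S-indep x∈ x∈S with Span-Img⇒lincomb x∈
  ... | λs , x≈ =
    ≈ᴹ-trans x≈ (lincomb-zero a (S-indep λs (IsSubspace.∈-resp S-sub x≈ x∈S)))

  module _ {a : Fin n → Carrierᴹ} {b : Fin k → Carrierᴹ} (S-sub : IsSubspace S) where
    open IsSubspace S-sub

    LinIndepOver-++ : LinIndepOver 𝔤 (Span 𝔤 (S ∪ Img 𝔤 b)) a → LinIndepOver 𝔤 S b →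
                      LinIndepOver 𝔤 S (a ++ b)
    LinIndepOver-++ a-indep b-indep λs combination∈S = ↑-elim λa≈0 λb≈0
      where
      la = lincomb 𝔤 (λs ∘ (_↑ˡ k)) a
      lb = lincomb 𝔤 (λs ∘ (n ↑ʳ_)) b
      la+lb∈S : S (la +ᴹ lb)
      la+lb∈S = ∈-resp (lincomb-++ n λs a b) combination∈S
      lb∈Span : Span 𝔤 (Img 𝔤 b) lb
      lb∈Span = IsSubspace.lincomb-∈ Span-isSubspace _ (λ j → inj (j , ≈ᴹ-refl))
      λa≈0 = a-indep _ (IsSubspace.∈-cancelʳ Span-isSubspace ≈ᴹ-refl
        (inj (inj₁ la+lb∈S)) (Span-mono inj₂ lb∈Span))
      λb≈0 = b-indep _
        (∈-cancelˡ ≈ᴹ-refl la+lb∈S (∈-resp (≈ᴹ-sym (lincomb-zero a λa≈0)) 0ᴹ∈))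

    LinIndepOver-++⁻ˡ : LinIndepOver 𝔤 S (a ++ b) → LinIndepOver 𝔤 (Span 𝔤 (S ∪ Img 𝔤 b)) a
    LinIndepOver-++⁻ˡ ab-indep λs la∈Span j with Span-∪⊆⊕ S-sub la∈Span
    ... | s , t , s∈S , t∈Span , la≈s+t with Span-Img⇒lincomb t∈Span
    ... | μs , t≈ = subst (_≈K 0#) (lookup-++ˡ λs νs j)
      (ab-indep (λs ++ νs) (∈-resp (≈ᴹ-sym combination≈s) s∈S) (j ↑ˡ k))
      where
      νs = λ i → - 1# * μs i
      combination≈s : lincomb 𝔤 (λs ++ νs) (a ++ b) ≈ᴹ s
      combination≈s = begin
        lincomb 𝔤 (λs ++ νs) (a ++ b)               ≈⟨ lincomb-++-++ λs νs a b ⟩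
        lincomb 𝔤 λs a +ᴹ lincomb 𝔤 νs b            ≈⟨ +ᴹ-congˡ (lincomb-* (- 1#) μs b) ⟩
        lincomb 𝔤 λs a +ᴹ (- 1#) *ₗ lincomb 𝔤 μs b  ≈⟨ +ᴹ-congˡ (-1*ₗx≈-ᴹx _) ⟩
        lincomb 𝔤 λs a +ᴹ -ᴹ lincomb 𝔤 μs b         ≈⟨ +ᴹ-cong la≈s+t (-ᴹ‿cong (≈ᴹ-sym t≈)) ⟩
        s +ᴹ t +ᴹ -ᴹ t                              ≈⟨ //-rightDividesʳ t s ⟩
        s                                           ∎

    LinIndepOver-++⁻ʳ : LinIndepOver 𝔤 S (a ++ b) → LinIndepOver 𝔤 S b
    LinIndepOver-++⁻ʳ ab-indep μs lb∈S j =
      subst (_≈K 0#) (lookup-++ʳ zeros μs j)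
        (ab-indep (zeros ++ μs) (∈-resp (≈ᴹ-sym combination≈lb) lb∈S) (n ↑ʳ j))
      where
      zeros = λ (_ : Fin n) → 0#
      combination≈lb : lincomb 𝔤 (zeros ++ μs) (a ++ b) ≈ᴹ lincomb 𝔤 μs b
      combination≈lb = begin
        lincomb 𝔤 (zeros ++ μs) (a ++ b)      ≈⟨ lincomb-++-++ zeros μs a b ⟩
        lincomb 𝔤 zeros a +ᴹ lincomb 𝔤 μs b   ≈⟨ +ᴹ-congʳ (lincomb-zero a (λ _ → ≈K-refl)) ⟩
        0ᴹ +ᴹ lincomb 𝔤 μs b                  ≈⟨ +ᴹ-identityˡ _ ⟩
        lincomb 𝔤 μs b                        ∎

module MalcevProperties {f ℓf : Level} {F : Field f ℓf} {c : ℕ} {m ℓm ℓp : Level}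
                        (L : LLA F c m ℓm ℓp) where
  open LLA L hiding ([_,_])
  open LinearAlgebra lie

  private
    variable
      ℓc : Level
      C : Pred Carrierᴹ ℓc
      i n k : ℕ

  P-isSubspace : 1 ≤ i → IsSubspace (P i)
  P-isSubspace 1≤i = IsSubalgebra⇒IsSubspace (P-sub _ 1≤i)

  Pᵢ-of⊆P : ∀ {a : Fin n → Carrierᴹ} → 1 ≤ i → Pᵢ-of L i a ⊆ P i
  Pᵢ-of⊆P 1≤i (_ , aj∈P , x≈aj) = IsSubspace.∈-resp (P-isSubspace 1≤i) (≈ᴹ-sym x≈aj) aj∈P

  Pᵢ-of⊆Img : ∀ {a : Fin n → Carrierᴹ} → Pᵢ-of L i a ⊆ Img lie a
  Pᵢ-of⊆Img (j , _ , x≈aj) = j , x≈aj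

  module _ (a : Fin n → Carrierᴹ) (b : Fin k → Carrierᴹ) where

    Pᵢ-of-++⁻ : Pᵢ-of L i (a ++ b) ⊆ Pᵢ-of L i a ∪ Pᵢ-of L i b
    Pᵢ-of-++⁻ {i} {x} = ∃-++⁻ (λ y → P i y × x ≈ᴹ y) a b

    Pᵢ-of-++⁺ˡ : Pᵢ-of L i a ⊆ Pᵢ-of L i (a ++ b)
    Pᵢ-of-++⁺ˡ {i} {x} = ∃-++⁺ˡ (λ y → P i y × x ≈ᴹ y) a b

    Pᵢ-of-++⁺ʳ : Pᵢ-of L i b ⊆ Pᵢ-of L i (a ++ b)
    Pᵢ-of-++⁺ʳ {i} {x} = ∃-++⁺ʳ (λ y → P i y × x ≈ᴹ y) a b

    ⟨C∙b⟩⊆⟨C∙a++b⟩ : ⟨_∙_⟩ L C b ⊆ ⟨_∙_⟩ L C (a ++ b)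
    ⟨C∙b⟩⊆⟨C∙a++b⟩ = Gen-mono (map₂ (Img-++⁺ʳ a b))

    ⟨⟨C∙b⟩∙a⟩⊆⟨C∙a++b⟩ : ⟨_∙_⟩ L (⟨_∙_⟩ L C b) a ⊆ ⟨_∙_⟩ L C (a ++ b)
    ⟨⟨C∙b⟩∙a⟩⊆⟨C∙a++b⟩ = Gen-least Gen-isSubalgebra λ where
      (inj₁ x∈⟨C∙b⟩) → ⟨C∙b⟩⊆⟨C∙a++b⟩ x∈⟨C∙b⟩
      (inj₂ x∈a)     → inj (inj₂ (Img-++⁺ˡ a b x∈a))

    ⟨C∙a++b⟩⊆⟨⟨C∙b⟩∙a⟩ : ⟨_∙_⟩ L C (a ++ b) ⊆ ⟨_∙_⟩ L (⟨_∙_⟩ L C b) a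
    ⟨C∙a++b⟩⊆⟨⟨C∙b⟩∙a⟩ = Gen-mono λ where
      (inj₁ x∈C)  → inj₁ (inj (inj₁ x∈C))
      (inj₂ x∈ab) → [ inj₂ , (λ x∈b → inj₁ (inj (inj₂ x∈b))) ]′ (Img-++⁻ a b x∈ab)

  module _ {a : Fin n → Carrierᴹ} where

    Malcev-intro : LinIndepOver lie C a →
                   (∀ i → 1 ≤ i → i ≤ c → P i ∩ ⟨_∙_⟩ L C a ⊆ Span lie (C ∪ Pᵢ-of L i a)) →
                   Malcev L C a
    Malcev-intro a-indep spans = a-indep , λ i 1≤i i≤c →
      Span-least Span-isSubspace [ (λ x∈C → inj (inj₁ x∈C)) , spans i 1≤i i≤c ]′ ,
      Span-mono (map₂ λ x∈ → Pᵢ-of⊆P 1≤i x∈ , inj (inj₂ (Pᵢ-of⊆Img x∈)))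

    Malcev⇒spans : Malcev L C a → 1 ≤ i → i ≤ c →
                   P i ∩ ⟨_∙_⟩ L C a ⊆ Span lie (C ∪ Pᵢ-of L i a)
    Malcev⇒spans (_ , spans) 1≤i i≤c x∈ = proj₁ (spans _ 1≤i i≤c) (inj (inj₂ x∈))

    Malcev⇒⟨⟩⊆Span : 1 ≤ c → Malcev L C a → ⟨_∙_⟩ L C a ⊆ Span lie (C ∪ Img lie a)
    Malcev⇒⟨⟩⊆Span 1≤c malcev x∈ =
      Span-mono (map₂ Pᵢ-of⊆Img) (Malcev⇒spans malcev ≤-refl 1≤c (P-one _ , x∈))

  module _ {p} {C : Pred Carrierᴹ p} (C-sub : IsSubalgebra lie C)
           (a : Fin n → Carrierᴹ) (b : Fin k → Carrierᴹ) where
    private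
      C-subspace = IsSubalgebra⇒IsSubspace C-sub
      ⟨C∙b⟩ = ⟨_∙_⟩ L C b
      ⟨C∙b⟩-subspace = IsSubalgebra⇒IsSubspace (Gen-isSubalgebra {X = C ∪ Img lie b})

    Malcev-++ : Malcev L ⟨C∙b⟩ a → Malcev L C b → Malcev L C (a ++ b)
    Malcev-++ a-malcev b-malcev = Malcev-intro ab-indep spans
      where
      -- Y must be given: LinIndepOver unfolds to a Π-type from which it cannot be inferred.
      ab-indep = LinIndepOver-++ C-subspace
        (LinIndepOver-anti {Y = ⟨C∙b⟩} Span⊆Gen (proj₁ a-malcev)) (proj₁ b-malcev)

      spans : ∀ i → 1 ≤ i → i ≤ c →
              P i ∩ ⟨_∙_⟩ L C (a ++ b) ⊆ Span lie (C ∪ Pᵢ-of L i (a ++ b))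
      spans i 1≤i i≤c (x∈P , x∈⟨⟩)
        with Span-∪⊆⊕ ⟨C∙b⟩-subspace
               (Malcev⇒spans a-malcev 1≤i i≤c (x∈P , ⟨C∙a++b⟩⊆⟨⟨C∙b⟩∙a⟩ a b x∈⟨⟩))
      ... | d , s , d∈⟨C∙b⟩ , s∈ , x≈d+s =
        resp (≈ᴹ-sym x≈d+s)
             (+∈ (Span-mono (map₂ (Pᵢ-of-++⁺ʳ a b)) d∈) (Span-mono (inj₂ ∘ Pᵢ-of-++⁺ˡ a b) s∈))
        where
        s∈P = Span-least (P-isSubspace 1≤i) (Pᵢ-of⊆P 1≤i) s∈
        d∈P = IsSubspace.∈-cancelʳ (P-isSubspace 1≤i) x≈d+s x∈P s∈P
        d∈ = Malcev⇒spans b-malcev 1≤i i≤c (d∈P , d∈⟨C∙b⟩)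

    Malcev-++⁻ˡ : 1 ≤ c → Malcev L C b → Malcev L C (a ++ b) → Malcev L ⟨C∙b⟩ a
    Malcev-++⁻ˡ 1≤c b-malcev ab-malcev = Malcev-intro a-indep λ i 1≤i i≤c (x∈P , x∈⟨⟩) →
      Span-mono (regroup i)
        (Malcev⇒spans ab-malcev 1≤i i≤c (x∈P , ⟨⟨C∙b⟩∙a⟩⊆⟨C∙a++b⟩ a b x∈⟨⟩))
      where
      a-indep = LinIndepOver-anti {Y = Span lie (C ∪ Img lie b)}
        (Malcev⇒⟨⟩⊆Span 1≤c b-malcev) (LinIndepOver-++⁻ˡ C-subspace (proj₁ ab-malcev))

      regroup : ∀ i → C ∪ Pᵢ-of L i (a ++ b) ⊆ ⟨C∙b⟩ ∪ Pᵢ-of L i a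
      regroup i (inj₁ x∈C)  = inj₁ (inj (inj₁ x∈C))
      regroup i (inj₂ x∈ab) =
        [ inj₂ , (λ x∈b → inj₁ (inj (inj₂ (Pᵢ-of⊆Img x∈b)))) ]′ (Pᵢ-of-++⁻ a b x∈ab)

    Malcev-++⁻ʳ : Malcev L ⟨C∙b⟩ a → Malcev L C (a ++ b) → Malcev L C b
    Malcev-++⁻ʳ a-malcev ab-malcev =
      Malcev-intro (LinIndepOver-++⁻ʳ C-subspace (proj₁ ab-malcev)) spans
      where
      regroup : ∀ i → C ∪ Pᵢ-of L i (a ++ b) ⊆ Span lie (C ∪ Pᵢ-of L i b) ∪ Img lie a
      regroup i (inj₁ x∈C)  = inj₁ (inj (inj₁ x∈C))
      regroup i (inj₂ x∈ab) =
        [ (λ x∈a → inj₂ (Pᵢ-of⊆Img x∈a)) , (λ x∈b → inj₁ (inj (inj₂ x∈b))) ]′ (Pᵢ-of-++⁻ a b x∈ab)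

      spans : ∀ i → 1 ≤ i → i ≤ c → P i ∩ ⟨C∙b⟩ ⊆ Span lie (C ∪ Pᵢ-of L i b)
      spans i 1≤i i≤c (x∈P , x∈⟨C∙b⟩)
        with Span-∪⊆⊕ Span-isSubspace (Span-mono (regroup i)
               (Malcev⇒spans ab-malcev 1≤i i≤c (x∈P , ⟨C∙b⟩⊆⟨C∙a++b⟩ a b x∈⟨C∙b⟩)))
      ... | r , s , r∈ , s∈ , x≈r+s = resp (≈ᴹ-sym x≈r) r∈
        where
        r∈⟨C∙b⟩ = Span⊆Gen (Span-mono (map₂ Pᵢ-of⊆Img) r∈)
        s≈0 = LinIndepOver⇒Span∩≈0 ⟨C∙b⟩-subspace (proj₁ a-malcev) s∈
          (IsSubspace.∈-cancelˡ ⟨C∙b⟩-subspace x≈r+s x∈⟨C∙b⟩ r∈⟨C∙b⟩)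
        x≈r = ≈ᴹ-trans x≈r+s (≈ᴹ-trans (+ᴹ-congˡ s≈0) (+ᴹ-identityʳ r))

lemma4p28 : ∀ {f ℓf m ℓm ℓp p : Level} (F : Field f ℓf) (c : ℕ) → 1 ≤ c →
    (L : LLA F c m ℓm ℓp) →
    let open LLA L in
    ∀ {n k : ℕ} (a : Fin n → Carrierᴹ) (b : Fin k → Carrierᴹ)
      (C : Pred Carrierᴹ p) → IsSubalgebra lie C →
      ((Malcev L (⟨_∙_⟩ L C b) a → Malcev L C b → Malcev L C (a ++ b)) ×
       (Malcev L C b → Malcev L C (a ++ b) → Malcev L (⟨_∙_⟩ L C b) a) ×
       (Malcev L (⟨_∙_⟩ L C b) a → Malcev L C (a ++ b) → Malcev L C b))
lemma4p28 F c 1≤c L a b C C-sub =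
  Malcev-++ C-sub a b , Malcev-++⁻ˡ C-sub a b 1≤c , Malcev-++⁻ʳ C-sub a b
  where open MalcevProperties L
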